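{- Let $G$ be an $\alpha$-excellent graph. Then the simplexes of $G$ are pairwise vertex-disjoint. In particular, $G$ contains no strong support vertex.
   Context: All graphs are finite and simple. $\alpha(G)$ is the independence number of $G$, and an $\alpha$-set of $G$ is an independent set of cardinality $\alpha(G)$. A graph $G$ is $\alpha$-excellent if every vertex of $G$ is contained in some $\alpha$-set of $G$. A vertex $v$ is simplicial if every two vertices of $N_G(v)$ are adjacent; a clique is a maximal complete subgraph; a simplex of $G$ is a clique of $G$ containing at least one simplicial vertex of $G$. A strong support vertex is a vertex with at least two neighbors of degree $1$. -}

module Defs where

open import Data.Nat using (ℕ; _≤_)
open import Data.Fin using (Fin)
open import Data.Fin.Subset using (Subset; _∈_; _∉_; _⊆_; ∣_∣)
open import Data.Product using (Σ; ∃; ∃-syntax; _×_; _,_)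
open import Relation.Nullary using (¬_)
open import Relation.Binary.PropositionalEquality using (_≡_; _≢_)
open import Level using (0ℓ)

record Graph : Set₁ where
  field
    n     : ℕ
    Adj   : Fin n → Fin n → Set
    sym   : ∀ {u v} → Adj u v → Adj v u
    irrefl : ∀ {v} → ¬ Adj v v

module _ (G : Graph) where
  open Graph G

  Vertex : Set
  Vertex = Fin n

  Independent : Subset n → Set
  Independent S = ∀ {u v} → u ∈ S → v ∈ S → ¬ Adj u v

  IsAlphaSet : Subset n → Set
  IsAlphaSet S = Independent S × (∀ T → Independent T → ∣ T ∣ ≤ ∣ S ∣)

  AlphaExcellent : Set
  AlphaExcellent = ∀ (v : Vertex) → ∃[ S ] (IsAlphaSet S × v ∈ S)

  Simplicial : Vertex → Set
  Simplicial v = ∀ {u w} → Adj v u → Adj v w → u ≢ w → Adj u w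

  Complete : Subset n → Set
  Complete K = ∀ {u v} → u ∈ K → v ∈ K → u ≢ v → Adj u v

  IsClique : Subset n → Set
  IsClique K = Complete K × (∀ L → Complete L → K ⊆ L → L ⊆ K)

  IsSimplex : Subset n → Set
  IsSimplex K = IsClique K × ∃[ v ] (v ∈ K × Simplicial v)

  DegreeOne : Vertex → Set
  DegreeOne u = ∃[ w ] (Adj u w × (∀ w' → Adj u w' → w' ≡ w))

  StrongSupport : Vertex → Set
  StrongSupport v = ∃[ a ] ∃[ b ] (a ≢ b × Adj v a × Adj v b × DegreeOne a × DegreeOne b)

module Submission where

open import Defs
open import Data.Fin.Subset using (_∈_)
open import Data.Product using (_×_; ∃-syntax)
open import Relation.Nullary using (¬_)
open import Relation.Binary.PropositionalEquality using (_≢_)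

open import Data.Nat using (suc; _<_)
open import Data.Nat.Properties using (<⇒≱; module ≤-Reasoning)
open import Data.Fin using (Fin; _≟_)
open import Data.Fin.Subset
  using (Subset; inside; outside; _∉_; _⊆_; _─_; _-_; _∪_; ⁅_⁆; ∣_∣)
open import Data.Fin.Subset.Properties
  using ( p─⊥≡p; p─q⊆p; p⊆p∪q; x∈p∪q⁺; x∈p∪q⁻; x∈⁅x⁆; x∈⁅y⁆⇒x≡y
        ; ⊆-antisym; p⊂q⇒∣p∣<∣q∣)
open import Data.Vec.Base using (_∷_; here; there)
open import Data.Product using (_,_; proj₁)
open import Data.Sum using (inj₁; inj₂)
open import Data.Empty using (⊥)
open import Relation.Nullary using (yes; no; contradiction)
open import Relation.Binary.PropositionalEquality using (_≡_; refl; sym; trans; cong)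

-- A simplicial vertex s has at most one neighbour in any independent set S.
-- So if v ∈ S is a common neighbour of two non-adjacent simplicial vertices
-- s and t, then (S - v) ∪ {s, t} is independent and larger than S; hence no
-- α-set contains v, and G is not α-excellent. Two distinct simplexes K, L
-- sharing a vertex v produce such s, t: the closed neighbourhood of a
-- simplicial vertex is the unique clique containing it, so the simplicial
-- vertex of K lies outside L and is not adjacent to that of L. Two leaves at
-- a strong support vertex are such a pair as well.

x∈p─q⇒x∉q : ∀ {n} {x : Fin n} (p q : Subset n) → x ∈ p ─ q → x ∉ q
x∈p─q⇒x∉q (_ ∷ p) (outside ∷ q) here        ()
x∈p─q⇒x∉q (_ ∷ p) (_       ∷ q) (there x∈) (there x∈q) = x∈p─q⇒x∉q p q x∈ x∈q

x∈p⇒suc∣p-x∣≡∣p∣ : ∀ {n} {x : Fin n} {p : Subset n} → x ∈ p → suc ∣ p - x ∣ ≡ ∣ p ∣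
x∈p⇒suc∣p-x∣≡∣p∣ {p = inside ∷ p}  here       = cong (λ q → suc ∣ q ∣) (p─⊥≡p p)
x∈p⇒suc∣p-x∣≡∣p∣ {p = inside ∷ p}  (there x∈) = cong suc (x∈p⇒suc∣p-x∣≡∣p∣ x∈)
x∈p⇒suc∣p-x∣≡∣p∣ {p = outside ∷ p} (there x∈) = x∈p⇒suc∣p-x∣≡∣p∣ x∈

x∉p⇒∣p∣<∣p∪⁅x⁆∣ : ∀ {n} {x : Fin n} {p : Subset n} → x ∉ p → ∣ p ∣ < ∣ p ∪ ⁅ x ⁆ ∣
x∉p⇒∣p∣<∣p∪⁅x⁆∣ {x = x} x∉p =
  p⊂q⇒∣p∣<∣q∣ (p⊆p∪q ⁅ x ⁆ , x , x∈p∪q⁺ (inj₂ (x∈⁅x⁆ x)) , x∉p)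

module _ (G : Graph) where
  open Graph G renaming (sym to Adj-sym)

  Independent-⊆ : ∀ {S T} → T ⊆ S → Independent G S → Independent G T
  Independent-⊆ T⊆S indS u∈T v∈T = indS (T⊆S u∈T) (T⊆S v∈T)

  Independent-∪⁅⁆ : ∀ {S x} → Independent G S → (∀ {y} → y ∈ S → ¬ Adj x y) →
                    Independent G (S ∪ ⁅ x ⁆)
  Independent-∪⁅⁆ {S} {x} indS x⊥S {u} {v} u∈ v∈ with x∈p∪q⁻ S ⁅ x ⁆ u∈ | x∈p∪q⁻ S ⁅ x ⁆ v∈
  ... | inj₁ u∈S | inj₁ v∈S = indS u∈S v∈S
  ... | inj₁ u∈S | inj₂ v∈x rewrite x∈⁅y⁆⇒x≡y x v∈x = λ ux → x⊥S u∈S (Adj-sym ux)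
  ... | inj₂ u∈x | inj₁ v∈S rewrite x∈⁅y⁆⇒x≡y x u∈x = x⊥S v∈S
  ... | inj₂ u∈x | inj₂ v∈x rewrite x∈⁅y⁆⇒x≡y x u∈x | x∈⁅y⁆⇒x≡y x v∈x = irrefl

  Complete-∪⁅⁆ : ∀ {K x} → Complete G K → (∀ {y} → y ∈ K → x ≢ y → Adj x y) →
                 Complete G (K ∪ ⁅ x ⁆)
  Complete-∪⁅⁆ {K} {x} compK x~K {u} {v} u∈ v∈ u≢v with x∈p∪q⁻ K ⁅ x ⁆ u∈ | x∈p∪q⁻ K ⁅ x ⁆ v∈
  ... | inj₁ u∈K | inj₁ v∈K = compK u∈K v∈K u≢v
  ... | inj₁ u∈K | inj₂ v∈x rewrite x∈⁅y⁆⇒x≡y x v∈x = Adj-sym (x~K u∈K (λ x≡u → u≢v (sym x≡u)))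
  ... | inj₂ u∈x | inj₁ v∈K rewrite x∈⁅y⁆⇒x≡y x u∈x = x~K v∈K u≢v
  ... | inj₂ u∈x | inj₂ v∈x =
    contradiction (trans (x∈⁅y⁆⇒x≡y x u∈x) (sym (x∈⁅y⁆⇒x≡y x v∈x))) u≢v

  simplicial⇒neighbour∈clique : ∀ {K s u} → IsClique G K → s ∈ K → Simplicial G s →
                                Adj s u → u ∈ K
  simplicial⇒neighbour∈clique {K} {s} {u} (compK , maxK) s∈K simp su =
    maxK (K ∪ ⁅ u ⁆) (Complete-∪⁅⁆ compK u~K) (p⊆p∪q ⁅ u ⁆) (x∈p∪q⁺ (inj₂ (x∈⁅x⁆ u)))
    where
    u~K : ∀ {y} → y ∈ K → u ≢ y → Adj u y
    u~K {y} y∈K u≢y with y ≟ s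
    ... | yes refl = Adj-sym su
    ... | no  y≢s  = simp su (compK s∈K y∈K (λ s≡y → y≢s (sym s≡y))) u≢y

  clique-unique-at-simplicial : ∀ {K L s} → IsClique G K → IsClique G L →
                                s ∈ K → s ∈ L → Simplicial G s → K ≡ L
  clique-unique-at-simplicial {K} {L} {s} cliqueK (compL , maxL) s∈K s∈L simp =
    ⊆-antisym (maxL K (proj₁ cliqueK) L⊆K) L⊆K
    where
    L⊆K : L ⊆ K
    L⊆K {x} x∈L with x ≟ s
    ... | yes refl = s∈K
    ... | no  x≢s  = simplicial⇒neighbour∈clique cliqueK s∈K simp
                       (compL s∈L x∈L (λ s≡x → x≢s (sym s≡x)))

  simplicial-neighbour-in-independent-unique :
    ∀ {S a x y} → Independent G S → Simplicial G a →
    x ∈ S → y ∈ S → Adj a x → Adj a y → x ≡ y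
  simplicial-neighbour-in-independent-unique {x = x} {y} indS simp x∈S y∈S ax ay with x ≟ y
  ... | yes x≡y = x≡y
  ... | no  x≢y = contradiction (simp ax ay x≢y) (indS x∈S y∈S)

  α-set-∌-common-neighbour-of-simplicial-pair :
    ∀ {S v s t} → IsAlphaSet G S → v ∈ S → Adj v s → Adj v t →
    s ≢ t → ¬ Adj s t → Simplicial G s → Simplicial G t → ⊥
  α-set-∌-common-neighbour-of-simplicial-pair {S} {v} {s} {t}
    (indS , maxS) v∈S vs vt s≢t ¬st simpS simpT = <⇒≱ ∣S∣<∣T∣ (maxS T indT)
    where
    S′ S″ T : Subset n
    S′ = S - v
    S″ = S′ ∪ ⁅ s ⁆
    T  = S″ ∪ ⁅ t ⁆

    S′⊆S : S′ ⊆ S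
    S′⊆S = p─q⊆p S ⁅ v ⁆

    no-neighbour-in-S′ : ∀ {a} → Simplicial G a → Adj v a → ∀ {y} → y ∈ S′ → ¬ Adj a y
    no-neighbour-in-S′ simp va y∈S′ ay
      with simplicial-neighbour-in-independent-unique indS simp (S′⊆S y∈S′) v∈S ay (Adj-sym va)
    ... | refl = x∈p─q⇒x∉q S ⁅ v ⁆ y∈S′ (x∈⁅x⁆ v)

    s∉S′ : s ∉ S′
    s∉S′ s∈S′ = indS v∈S (S′⊆S s∈S′) vs

    t∉S″ : t ∉ S″
    t∉S″ t∈S″ with x∈p∪q⁻ S′ ⁅ s ⁆ t∈S″
    ... | inj₁ t∈S′ = indS v∈S (S′⊆S t∈S′) vt
    ... | inj₂ t∈s  = s≢t (sym (x∈⁅y⁆⇒x≡y s t∈s))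

    t-no-neighbour-in-S″ : ∀ {y} → y ∈ S″ → ¬ Adj t y
    t-no-neighbour-in-S″ y∈S″ with x∈p∪q⁻ S′ ⁅ s ⁆ y∈S″
    ... | inj₁ y∈S′ = no-neighbour-in-S′ simpT vt y∈S′
    ... | inj₂ y∈s rewrite x∈⁅y⁆⇒x≡y s y∈s = λ ts → ¬st (Adj-sym ts)

    indS″ : Independent G S″
    indS″ = Independent-∪⁅⁆ (Independent-⊆ S′⊆S indS) (no-neighbour-in-S′ simpS vs)

    indT : Independent G T
    indT = Independent-∪⁅⁆ indS″ t-no-neighbour-in-S″

    ∣S∣<∣T∣ : ∣ S ∣ < ∣ T ∣
    ∣S∣<∣T∣ = begin-strict
      ∣ S ∣       ≡⟨ sym (x∈p⇒suc∣p-x∣≡∣p∣ v∈S) ⟩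
      suc ∣ S′ ∣  ≤⟨ x∉p⇒∣p∣<∣p∪⁅x⁆∣ s∉S′ ⟩
      ∣ S″ ∣      <⟨ x∉p⇒∣p∣<∣p∪⁅x⁆∣ t∉S″ ⟩
      ∣ T ∣       ∎
      where open ≤-Reasoning

  α-excellent⇒no-common-neighbour-of-simplicial-pair :
    AlphaExcellent G → ∀ {v s t} → Adj v s → Adj v t →
    s ≢ t → ¬ Adj s t → Simplicial G s → Simplicial G t → ⊥
  α-excellent⇒no-common-neighbour-of-simplicial-pair excellent {v} vs vt s≢t ¬st simpS simpT
    with excellent v
  ... | S , αS , v∈S =
    α-set-∌-common-neighbour-of-simplicial-pair αS v∈S vs vt s≢t ¬st simpS simpT

  degreeOne-neighbour-unique : ∀ {a x y} → DegreeOne G a → Adj a x → Adj a y → x ≡ y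
  degreeOne-neighbour-unique (w , _ , only-w) ax ay = trans (only-w _ ax) (sym (only-w _ ay))

  degreeOne⇒simplicial : ∀ {a} → DegreeOne G a → Simplicial G a
  degreeOne⇒simplicial deg ax ay x≢y = contradiction (degreeOne-neighbour-unique deg ax ay) x≢y

  α-excellent⇒simplexes-disjoint :
    AlphaExcellent G → ∀ K L → IsSimplex G K → IsSimplex G L → K ≢ L → ∀ v → v ∈ K → v ∉ L
  α-excellent⇒simplexes-disjoint excellent K L
    (cliqueK , s , s∈K , simpS) (cliqueL , t , t∈L , simpT) K≢L v v∈K v∈L =
    α-excellent⇒no-common-neighbour-of-simplicial-pair excellent
      (proj₁ cliqueK v∈K s∈K v≢s) (proj₁ cliqueL v∈L t∈L v≢t) s≢t ¬st simpS simpT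
    where
    s∉L : s ∉ L
    s∉L s∈L = K≢L (clique-unique-at-simplicial cliqueK cliqueL s∈K s∈L simpS)

    t∉K : t ∉ K
    t∉K t∈K = K≢L (clique-unique-at-simplicial cliqueK cliqueL t∈K t∈L simpT)

    s≢t : s ≢ t
    s≢t refl = s∉L t∈L

    ¬st : ¬ Adj s t
    ¬st st = t∉K (simplicial⇒neighbour∈clique cliqueK s∈K simpS st)

    v≢s : v ≢ s
    v≢s refl = s∉L v∈L

    v≢t : v ≢ t
    v≢t refl = t∉K v∈K

  α-excellent⇒no-strong-support : AlphaExcellent G → ¬ (∃[ v ] StrongSupport G v)
  α-excellent⇒no-strong-support excellent (v , a , b , a≢b , va , vb , degA , degB) =
    α-excellent⇒no-common-neighbour-of-simplicial-pair excellent va vb a≢b ¬ab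
      (degreeOne⇒simplicial degA) (degreeOne⇒simplicial degB)
    where
    ¬ab : ¬ Adj a b
    ¬ab ab with degreeOne-neighbour-unique degA ab (Adj-sym va)
    ... | refl = irrefl vb

proposition2p1 : (G : Graph) → AlphaExcellent G →
    (∀ K L → IsSimplex G K → IsSimplex G L → K ≢ L → ∀ v → v ∈ K → ¬ (v ∈ L))
    × ¬ (∃[ v ] StrongSupport G v)
proposition2p1 G excellent =
  α-excellent⇒simplexes-disjoint G excellent , α-excellent⇒no-strong-support G excellent
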